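{- For every digraph $G$ the following statements are equivalent: (1) $G\in S_{1,1}$; (2) $G$ is a transitive tournament; (3) $G$ is an acyclic tournament; (4) $G$ is a $\overrightarrow{C_3}$-free tournament; (5) $G$ is a tournament with exactly one Hamiltonian path; (6) $G=(V,A)$ is a tournament and every vertex has a different outdegree, i.e. $\{\mathrm{outdegree}(v)\mid v\in V\}=\{0,\ldots,|V|-1\}$; (7) $G$ is $\{2\overleftrightarrow{K_1},\overleftrightarrow{K_2},\overrightarrow{C_3}\}$-free; (8) $G\in\{(\{v\},\emptyset)\}\cup\{(\overrightarrow{P_n})^{n-1}\mid n\geq 2\}$; (9) $G\in\mathcal{G}_{\{\mathrm{OD}\}}$; (10) $G\in\mathcal{G}_{\{\mathrm{ID}\}}$.
   Context: All digraphs are finite, without loops and without multiple arcs. A set of sequences $Q=\{q_1,\ldots,q_k\}$ consists of sequences $q_i=(b_{i,1},\ldots,b_{i,n_i})$ of pairwise distinct items, each item having a type $t(b_{i,j})$. The sequence digraph $g(Q)=(V,A)$ has as vertex set the set of all types occurring in $Q$, and $(u,v)\in A$ iff $u\neq v$ and in some $q_i$ an item of type $u$ occurs at a position strictly before an item of type $v$. $S_{k,\ell}$ is the class of all $g(Q)$ with $Q$ consisting of at most $k$ sequences and containing, summed over all sequences, at most $\ell$ items of each type. A digraph is $\mathcal F$-free if it has no induced subdigraph isomorphic to a member of $\mathcal F$. $2\overleftrightarrow{K_1}$ is the digraph with two vertices and no arcs; $\overleftrightarrow{K_2}$ is the digraph on two vertices $u,v$ with both arcs $(u,v),(v,u)$;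 $\overrightarrow{C_3}$ is the directed cycle on three vertices. A tournament has exactly one arc between every two distinct vertices. $\overrightarrow{P_n}$ is the directed path $v_1\to v_2\to\cdots\to v_n$, and for a digraph $H$ the power $H^m$ has the same vertices and an arc $(u,v)$ iff there is a directed path of length at most $m$ from $u$ to $v$ in $H$. For a digraph $H=(V,A)$ let $\mathrm{OD}(H)$ be obtained by adding a new vertex $v$ with arcs $(v,w)$ for all $w\in V$ and no arcs into $v$ (an out-dominating vertex), and $\mathrm{ID}(H)$ by adding a new vertex $v$ with arcs $(w,v)$ for all $w\in V$ and no arcs out of $v$ (an in-dominated vertex). For $o\in\{\mathrm{OD},\mathrm{ID}\}$, $\mathcal G_{\{o\}}$ is the smallest class containing the one-vertex digraph $(\{v\},\emptyset)$ and closed under the operation $o$. -}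

module Defs where

open import Data.Nat using (ℕ; zero; suc; _≤_; _<_; _+_)
open import Data.Bool using (Bool; true; false; T; _∧_; _∨_; not; if_then_else_)
open import Data.Fin using (Fin; zero; suc; toℕ; fromℕ; _≟_)
open import Data.Fin.Properties using () renaming (_≟_ to _≟F_)
open import Data.List using (List; []; _∷_; length; map; concat; allFin)
open import Data.Nat.ListAction using (sum)
open import Data.Bool.ListAction using (any)
open import Data.Product using (Σ; _×_; _,_; ∃)
open import Data.Sum using (_⊎_)
open import Relation.Nullary using (¬_; does)
open import Relation.Binary.PropositionalEquality using (_≡_; _≢_)
open import Function.Definitions using (Injective)

record Digraph : Set where
  field
    size     : ℕ
    arc      : Fin size → Fin size → Bool
    loopless : ∀ v → arc v v ≡ false
open Digraph public

Vtx : Digraph → Set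
Vtx G = Fin (size G)

Arc : (G : Digraph) → Vtx G → Vtx G → Set
Arc G u v = T (arc G u v)

_==_ : ∀ {n} → Fin n → Fin n → Bool
u == v = does (u ≟F v)

record _≅_ (G H : Digraph) : Set where
  field
    to       : Vtx G → Vtx H
    from     : Vtx H → Vtx G
    from-to  : ∀ v → from (to v) ≡ v
    to-from  : ∀ w → to (from w) ≡ w
    arc-pres : ∀ u v → arc G u v ≡ arc H (to u) (to v)

InducedSub : Digraph → Digraph → Set
InducedSub H G =
  Σ (Vtx H → Vtx G) λ f → Injective _≡_ _≡_ f × (∀ u v → arc H u v ≡ arc G (f u) (f v))

data Free (G : Digraph) : List Digraph → Set where
  []  : Free G []
  _∷_ : ∀ {H F} → ¬ InducedSub H G → Free G F → Free G (H ∷ F)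

IsTournament : Digraph → Set
IsTournament G = ∀ (u v : Vtx G) → u ≢ v →
  (Arc G u v × ¬ Arc G v u) ⊎ (Arc G v u × ¬ Arc G u v)

IsTransitive : Digraph → Set
IsTransitive G = ∀ (u v w : Vtx G) → Arc G u v → Arc G v w → u ≢ w → Arc G u w

DirectedCycle : Digraph → Set
DirectedCycle G = Σ ℕ λ k → Σ (Fin (suc (suc k)) → Vtx G) λ c →
  Injective _≡_ _≡_ c ×
  (∀ i j → toℕ j ≡ suc (toℕ i) → Arc G (c i) (c j)) ×
  Arc G (c (fromℕ (suc k))) (c zero)

IsAcyclic : Digraph → Set
IsAcyclic G = ¬ DirectedCycle G

HamPath : (G : Digraph) → (Fin (size G) → Vtx G) → Set
HamPath G p = Injective _≡_ _≡_ p × (∀ i j → toℕ j ≡ suc (toℕ i) → Arc G (p i) (p j))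

ExactlyOneHamPath : Digraph → Set
ExactlyOneHamPath G = Σ (Fin (size G) → Vtx G) λ p → HamPath G p ×
  (∀ q → HamPath G q → ∀ i → q i ≡ p i)

outdegree : (G : Digraph) → Vtx G → ℕ
outdegree G v = sum (map (λ u → if arc G v u then 1 else 0) (allFin (size G)))

OutdegreesAll : Digraph → Set
OutdegreesAll G = (∀ v → outdegree G v < size G) ×
                  (∀ k → k < size G → ∃ λ v → outdegree G v ≡ k)

K1 : Digraph
K1 = record { size = 1 ; arc = λ _ _ → false ; loopless = λ _ → _≡_.refl }

twoK1 : Digraph
twoK1 = record { size = 2 ; arc = λ _ _ → false ; loopless = λ _ → _≡_.refl }

biK2 : Digraph
biK2 = record { size = 2 ; arc = λ u v → not (u == v) ; loopless = lp }
  where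
  lp : ∀ v → not (v == v) ≡ false
  lp zero = _≡_.refl
  lp (suc zero) = _≡_.refl

C3arc : Fin 3 → Fin 3 → Bool
C3arc zero (suc zero) = true
C3arc (suc zero) (suc (suc zero)) = true
C3arc (suc (suc zero)) zero = true
C3arc _ _ = false

C3 : Digraph
C3 = record { size = 3 ; arc = C3arc ; loopless = lp }
  where
  lp : ∀ v → C3arc v v ≡ false
  lp zero = _≡_.refl
  lp (suc zero) = _≡_.refl
  lp (suc (suc zero)) = _≡_.refl

Pdir : ℕ → Digraph
Pdir n = record { size = n ; arc = λ i j → does (toℕ j Data.Nat.≟ suc (toℕ i)) ; loopless = lp }
  where
  open import Data.Nat.Properties using (<⇒≢; n<1+n)
  open import Relation.Nullary.Decidable using (dec-false)
  lp : ∀ (v : Fin n) → does (toℕ v Data.Nat.≟ suc (toℕ v)) ≡ false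
  lp v = dec-false (toℕ v Data.Nat.≟ suc (toℕ v)) (<⇒≢ (n<1+n (toℕ v)))

reach : (H : Digraph) → ℕ → Vtx H → Vtx H → Bool
reach H zero u v = u == v
reach H (suc m) u v = reach H m u v ∨ any (λ w → reach H m u w ∧ arc H w v) (allFin (size H))

-- power H^m : arc (u,v) iff u ≠ v and there is a directed path of length
-- at most m from u to v (for u ≠ v, equivalently a directed walk).
power : Digraph → ℕ → Digraph
power H m = record { size = size H ; arc = λ u v → not (u == v) ∧ reach H m u v ; loopless = lp }
  where
  open import Relation.Nullary.Decidable using (dec-true)
  open import Relation.Binary.PropositionalEquality using (refl)
  lp : ∀ v → not (v == v) ∧ reach H m v v ≡ false
  lp v rewrite dec-true (v ≟F v) refl = refl

-- OD and ID operations (new vertex is `zero`, old vertices are `suc w`)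

ODarc : (H : Digraph) → Fin (suc (size H)) → Fin (suc (size H)) → Bool
ODarc H zero zero = false
ODarc H zero (suc w) = true
ODarc H (suc u) zero = false
ODarc H (suc u) (suc w) = arc H u w

OD : Digraph → Digraph
OD H = record { size = suc (size H) ; arc = ODarc H ; loopless = lp }
  where
  lp : ∀ v → ODarc H v v ≡ false
  lp zero = _≡_.refl
  lp (suc v) = loopless H v

IDarc : (H : Digraph) → Fin (suc (size H)) → Fin (suc (size H)) → Bool
IDarc H zero zero = false
IDarc H zero (suc w) = false
IDarc H (suc u) zero = true
IDarc H (suc u) (suc w) = arc H u w

ID : Digraph → Digraph
ID H = record { size = suc (size H) ; arc = IDarc H ; loopless = lp }
  where
  lp : ∀ v → IDarc H v v ≡ false
  lp zero = _≡_.refl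
  lp (suc v) = loopless H v

data Gen (o : Digraph → Digraph) : Digraph → Set where
  base : Gen o K1
  step : ∀ {H} → Gen o H → Gen o (o H)

-- membership in the class G_{o}, which is closed under isomorphism
InGen : (Digraph → Digraph) → Digraph → Set
InGen o G = Σ Digraph λ H → Gen o H × (G ≅ H)

-- Sequence digraphs
-- A set of sequences with types in Fin t is a list of sequences; a sequence is
-- represented by the list of the types of its items (items themselves are
-- pairwise distinct and only their types and positions matter for g(Q)).

elem : ∀ {t} → Fin t → List (Fin t) → Bool
elem a xs = any (λ x → x == a) xs

before : ∀ {t} → Fin t → Fin t → List (Fin t) → Bool
before u v [] = false
before u v (x ∷ xs) = ((x == u) ∧ elem v xs) ∨ before u v xs

occ : ∀ {t} → Fin t → List (List (Fin t)) → ℕ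
occ a Q = sum (map (λ x → if x == a then 1 else 0) (concat Q))

-- g(Q) for Q whose occurring types are exactly Fin t
seqDigraph : (t : ℕ) → List (List (Fin t)) → Digraph
seqDigraph t Q = record
  { size = t
  ; arc = λ u v → not (u == v) ∧ any (before u v) Q
  ; loopless = lp }
  where
  open import Relation.Nullary.Decidable using (dec-true)
  open import Relation.Binary.PropositionalEquality using (refl)
  lp : ∀ v → not (v == v) ∧ any (before v v) Q ≡ false
  lp v rewrite dec-true (v ≟F v) refl = refl

InS : ℕ → ℕ → Digraph → Set
InS k ℓ G = Σ ℕ λ t → Σ (List (List (Fin t))) λ Q →
  length Q ≤ k ×
  (∀ a → 1 ≤ occ a Q) ×        -- vertex set = set of types occurring in Q
  (∀ a → occ a Q ≤ ℓ) ×
  (G ≅ seqDigraph t Q)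

module Submission where

-- Every condition is shown equivalent to (2), "G is a
-- transitive tournament", which serves as the hub.
--
-- The central fact is a normal form: in a transitive tournament the outdegree
-- strictly decreases along arcs, so it is an injective rank with values
-- 0, ..., n-1 and each vertex beats exactly the vertices of smaller outdegree
-- (module Ranking).  Hence a transitive tournament is isomorphic to the canonical
-- one, Desc n, and two transitive tournaments of equal size are isomorphic
-- (TT-unique).  Conversely a tournament admitting such a rank (ranked⇒TT) is
-- transitive.  With these tools:
--   (3), (4), (7): a tournament is transitive iff it has no directed triangle;
--   (5): along a Hamiltonian path the outdegrees must be n-1, ..., 0, and a
--        backward arc would allow rotating the unique path into a second one;
--   (6): with distinct outdegrees each vertex beats all lower ones, by downward
--        induction and counting;
--   (1), (8), (9), (10): sequence digraphs of one sequence, powers of directed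
--        paths and the classes generated by OD and ID consist of transitive
--        tournaments of every size, so TT-unique identifies G with one of them.

open import Defs
open import Data.Nat using (ℕ; zero; suc; pred; _<_; _≤_; _∸_; _+_; z≤n; s≤s; s≤s⁻¹; z<s; _<ᵇ_; _<?_; _≤?_; _≟_; >-nonZero)
open import Relation.Binary using (tri<; tri≈; tri>)
open import Data.Nat.Properties
open import Data.Nat.Induction using (<-rec)
open import Data.Bool using (Bool; true; false; T; if_then_else_; _∧_; _∨_; not)
open import Data.Bool.Properties using (T-∧; T-∨; T-not-≡; ∨-identityʳ)
open import Relation.Nullary.Decidable using (dec-true; dec-false)
open import Data.Bool.ListAction using (any)
open import Data.Unit using (tt)
open import Data.Empty using (⊥; ⊥-elim)
open import Data.Fin using (Fin; zero; suc; toℕ; fromℕ; fromℕ<; punchOut; opposite; inject₁)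
import Data.Fin.Properties as F
open import Data.Fin.Permutation using (permutation)
open import Data.List using (List; []; _∷_; map; tabulate; allFin)
open import Data.List.Properties using (++-identityʳ)
open import Data.List.Relation.Unary.Any using (satisfied)
open import Data.List.Relation.Unary.Any.Properties using (any⁺; any⁻)
open import Data.List.Membership.Propositional using (lose)
open import Data.List.Membership.Propositional.Properties using (∈-allFin)
open import Data.Nat.ListAction using (sum)
open import Data.Product using (Σ; _×_; _,_; proj₁; proj₂; ∃)
open import Data.Sum using (_⊎_; inj₁; inj₂)
open import Function.Bundles using (_⇔_; mk⇔)
open import Relation.Nullary using (¬_; Dec; yes; no; does)
import Function.Bundles as ⇔ using (module Equivalence)
open import Relation.Binary.PropositionalEquality
open import Function.Definitions using (Injective)
open import Algebra.Properties.CommutativeMonoid.Sum +-0-commutativeMonoid as Sum using ()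

T-ext : ∀ {a b : Bool} → (T a → T b) → (T b → T a) → a ≡ b
T-ext {false} {false} _ _ = refl
T-ext {false} {true}  _ g = ⊥-elim (g tt)
T-ext {true}  {false} f _ = ⊥-elim (f tt)
T-ext {true}  {true}  _ _ = refl

T⇒≡true : ∀ {a} → T a → a ≡ true
T⇒≡true {true} _ = refl

≡true⇒T : ∀ {a} → a ≡ true → T a
≡true⇒T refl = tt

¬T⇒≡false : ∀ {a} → ¬ T a → a ≡ false
¬T⇒≡false {false} _ = refl
¬T⇒≡false {true}  f = ⊥-elim (f tt)

≡false⇒¬T : ∀ {a} → a ≡ false → ¬ T a
≡false⇒¬T refl ()

does⇒ : ∀ {P : Set} (d : Dec P) → T (does d) → P
does⇒ (yes p) _ = p

⇒does : ∀ {P : Set} (d : Dec P) → P → T (does d)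
⇒does (yes _) _ = tt
⇒does (no ¬p) p = ¬p p

==⇒≡ : ∀ {n} {u v : Fin n} → T (u == v) → u ≡ v
==⇒≡ {u = u} {v} = does⇒ (u F.≟ v)

≡⇒== : ∀ {n} {u v : Fin n} → u ≡ v → T (u == v)
≡⇒== {u = u} {v} = ⇒does (u F.≟ v)

indicator : Bool → ℕ
indicator b = if b then 1 else 0

indicator-mono : ∀ {a b} → (T a → T b) → indicator a ≤ indicator b
indicator-mono {false} _ = z≤n
indicator-mono {true} {true} _ = ≤-refl
indicator-mono {true} {false} f = ⊥-elim (f tt)

sum-mono : ∀ {n} {f g : Fin n → ℕ} → (∀ i → f i ≤ g i) → Sum.sum f ≤ Sum.sum g
sum-mono {zero}  f≤g = z≤n
sum-mono {suc n} f≤g = +-mono-≤ (f≤g zero) (sum-mono (λ i → f≤g (suc i)))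

sum-strict : ∀ {n} {f g : Fin n → ℕ} → (∀ i → f i ≤ g i) → ∀ j → f j < g j → Sum.sum f < Sum.sum g
sum-strict {suc n} f≤g zero    fj<gj = +-mono-<-≤ fj<gj (sum-mono (λ i → f≤g (suc i)))
sum-strict {suc n} f≤g (suc j) fj<gj = +-mono-≤-< (f≤g zero) (sum-strict (λ i → f≤g (suc i)) j fj<gj)

count : ∀ {n} → (Fin n → Bool) → ℕ
count p = Sum.sum (λ i → indicator (p i))

count-strict : ∀ {n} {p q : Fin n → Bool} → (∀ i → T (p i) → T (q i)) →
  ∀ j → T (q j) → ¬ T (p j) → count p < count q
count-strict {p = p} {q} p⊆q j qj ¬pj = sum-strict (λ i → indicator-mono (p⊆q i)) j
  (subst₂ (λ a b → indicator a < indicator b) (sym (¬T⇒≡false ¬pj)) (sym (T⇒≡true qj)) ≤-refl)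

count-≡⇒⊇ : ∀ {n} {p q : Fin n → Bool} → (∀ i → T (p i) → T (q i)) → count p ≡ count q →
  ∀ i → T (q i) → T (p i)
count-≡⇒⊇ {p = p} p⊆q same i qi with p i in pi
... | true  = tt
... | false = ⊥-elim (<-irrefl same (count-strict p⊆q i qi (≡false⇒¬T pi)))

count-cong : ∀ {n} {p q : Fin n → Bool} → (∀ i → p i ≡ q i) → count p ≡ count q
count-cong p≗q = Sum.sum-cong-≗ (λ i → cong indicator (p≗q i))

count-all : ∀ n → count {n} (λ _ → true) ≡ n
count-all zero    = refl
count-all (suc n) = cong suc (count-all n)

count-below : ∀ n m → m ≤ n → count {n} (λ i → toℕ i <ᵇ m) ≡ m
count-below n       zero    _         = Sum.sum-replicate-zero n
count-below (suc n) (suc m) (s≤s m≤n) = cong suc (count-below n m m≤n)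

count-single : ∀ {n} (a : Fin n) → count (λ i → i == a) ≡ 1
count-single {suc n} zero    = cong suc (Sum.sum-replicate-zero n)
count-single {suc n} (suc a) = count-single a

count-permute : ∀ {n} (p : Fin n → Bool) (σ τ : Fin n → Fin n) →
  (∀ y → σ (τ y) ≡ y) → (∀ x → τ (σ x) ≡ x) → count (λ x → p (σ x)) ≡ count p
count-permute p σ τ στ τσ = sym (Sum.sum-permute (λ i → indicator (p i)) (permutation σ τ στ τσ))

sum-tabulate : ∀ {A : Set} {n} (f : A → ℕ) (g : Fin n → A) →
  sum (map f (tabulate g)) ≡ Sum.sum (λ i → f (g i))
sum-tabulate {n = zero}  f g = refl
sum-tabulate {n = suc n} f g = cong (f (g zero) +_) (sum-tabulate f (λ i → g (suc i)))

outdegree≡count : ∀ G v → outdegree G v ≡ count (arc G v)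
outdegree≡count G v = sum-tabulate (λ u → indicator (arc G v u)) (λ i → i)

injective⇒surjective : ∀ {n} (f : Fin n → Fin n) → Injective _≡_ _≡_ f → ∀ y → ∃ λ x → f x ≡ y
injective⇒surjective {suc m} f inj y with F.any? (λ x → f x F.≟ y)
... | yes hit = hit
... | no miss = ⊥-elim (<-irrefl refl (F.injective⇒≤ {f = avoid} avoid-injective))
  where
  -- if f missed y it would inject Fin (suc m) into Fin m
  y≢f : ∀ x → y ≢ f x
  y≢f x y≡fx = miss (x , sym y≡fx)
  avoid : Fin (suc m) → Fin m
  avoid x = punchOut (y≢f x)
  avoid-injective : Injective _≡_ _≡_ avoid
  avoid-injective same = inj (F.punchOut-injective (y≢f _) (y≢f _) same)

left-inverse⇒right-inverse : ∀ {n} (f g : Fin n → Fin n) → (∀ x → g (f x) ≡ x) → ∀ y → f (g y) ≡ y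
left-inverse⇒right-inverse f g gf y with injective⇒surjective f f-injective y
  where
  f-injective : Injective _≡_ _≡_ f
  f-injective {a} {b} fa≡fb = trans (sym (gf a)) (trans (cong g fa≡fb) (gf b))
... | x , refl = cong f (gf x)

opposite-antitone : ∀ {n} {i j : Fin n} → toℕ i < toℕ j → toℕ (opposite j) < toℕ (opposite i)
opposite-antitone {i = i} {j} i<j = subst₂ _<_ (sym (F.opposite-prop j)) (sym (F.opposite-prop i))
  (∸-monoʳ-< (s≤s i<j) (F.toℕ<n j))

opposite-reflects : ∀ {n} {i j : Fin n} → toℕ (opposite j) < toℕ (opposite i) → toℕ i < toℕ j
opposite-reflects {i = i} {j} lt =
  subst₂ (λ a b → toℕ a < toℕ b) (F.opposite-involutive i) (F.opposite-involutive j) (opposite-antitone lt)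

opposite-reverses : ∀ {n} (i j : Fin n) → (toℕ (opposite j) <ᵇ toℕ (opposite i)) ≡ (toℕ i <ᵇ toℕ j)
opposite-reverses i j = T-ext
  (λ lt → <⇒<ᵇ (opposite-reflects (<ᵇ⇒< (toℕ (opposite j)) (toℕ (opposite i)) lt)))
  (λ lt → <⇒<ᵇ (opposite-antitone (<ᵇ⇒< (toℕ i) (toℕ j) lt)))

opposite-injective : ∀ {n} → Injective _≡_ _≡_ (opposite {n})
opposite-injective {x = i} {j} same =
  trans (sym (F.opposite-involutive i)) (trans (cong opposite same) (F.opposite-involutive j))

-- A finite sequence s : Fin n → A viewed as an ℕ-indexed one, with a default
-- value beyond its end.  This lets index arithmetic happen in ℕ.
at : ∀ {A : Set} {n} → A → (Fin n → A) → ℕ → A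
at {n = n} d s m with m <? n
... | yes m<n = s (fromℕ< m<n)
... | no  _   = d

at-fromℕ< : ∀ {A : Set} {n} {d : A} {s : Fin n → A} {m} (m<n : m < n) → at d s m ≡ s (fromℕ< m<n)
at-fromℕ< {n = n} {m = m} m<n with m <? n
... | yes _   = refl
... | no  m≮n = ⊥-elim (m≮n m<n)

at-toℕ : ∀ {A : Set} {n} {d : A} {s : Fin n → A} (i : Fin n) → at d s (toℕ i) ≡ s i
at-toℕ {s = s} i = trans (at-fromℕ< (F.toℕ<n i)) (cong s (F.fromℕ<-toℕ i (F.toℕ<n i)))

at-injective : ∀ {A : Set} {n} {d : A} {s : Fin n → A} → Injective _≡_ _≡_ s →
  ∀ {a b} → a < n → b < n → at d s a ≡ at d s b → a ≡ b
at-injective {s = s} inj {a} {b} a<n b<n same =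
  trans (sym (F.toℕ-fromℕ< a<n))
    (trans (cong toℕ (inj (trans (sym (at-fromℕ< a<n)) (trans same (at-fromℕ< b<n)))))
      (F.toℕ-fromℕ< b<n))

Consecutive : ∀ {A : Set} {n} → (A → A → Set) → (Fin n → A) → Set
Consecutive R s = ∀ i j → toℕ j ≡ suc (toℕ i) → R (s i) (s j)

consecutive-at : ∀ {A : Set} {n} {R : A → A → Set} {d : A} {s : Fin n → A} → Consecutive R s →
  ∀ a → suc a < n → R (at d s a) (at d s (suc a))
consecutive-at {R = R} {s = s} cons a sa<n =
  subst₂ R (sym (at-fromℕ< a<n)) (sym (at-fromℕ< sa<n))
    (cons (fromℕ< a<n) (fromℕ< sa<n) (trans (F.toℕ-fromℕ< sa<n) (cong suc (sym (F.toℕ-fromℕ< a<n)))))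
  where
  a<n = <-trans (n<1+n a) sa<n

Descending : ℕ → (ℕ → ℕ) → Set
Descending n g = ∀ a → suc a < n → g (suc a) < g a

descent : ∀ {n} g → Descending n g → ∀ a k → a + k < n → g (a + k) + k ≤ g a
descent g desc a zero _ = ≤-reflexive (trans (+-identityʳ _) (cong g (+-identityʳ a)))
descent {n} g desc a (suc k) a+sk<n = begin
  g (a + suc k) + suc k     ≡⟨ cong (λ x → g x + suc k) (+-suc a k) ⟩
  g (suc (a + k)) + suc k   ≡⟨ +-suc (g (suc (a + k))) k ⟩
  suc (g (suc (a + k)) + k) ≤⟨ +-monoˡ-< k (desc (a + k) sa+k<n) ⟩
  g (a + k) + k             ≤⟨ descent g desc a k (<-trans (n<1+n _) sa+k<n) ⟩
  g a                       ∎
  where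
  open ≤-Reasoning
  sa+k<n : suc (a + k) < n
  sa+k<n = subst (_< n) (+-suc a k) a+sk<n

descending-exact : ∀ n g → Descending n g → (∀ a → a < n → g a < n) → ∀ a → a < n → g a ≡ n ∸ suc a
descending-exact (suc m) g desc bounded a a<n = ≤-antisym upper lower
  where
  -- the first a steps descend from g 0 ≤ m
  upper : g a ≤ m ∸ a
  upper = m+n≤o⇒m≤o∸n (g a) (≤-trans (descent g desc 0 a a<n) (s≤s⁻¹ (bounded 0 z<s)))
  -- the remaining m - a steps descend from g a to g m ≥ 0
  a+[m∸a]≡m : a + (m ∸ a) ≡ m
  a+[m∸a]≡m = m+[n∸m]≡n (s≤s⁻¹ a<n)
  lower : m ∸ a ≤ g a
  lower = m+n≤o⇒n≤o (g m) (subst (λ x → g x + (m ∸ a) ≤ g a) a+[m∸a]≡m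
    (descent g desc a (m ∸ a) (subst (_< suc m) (sym a+[m∸a]≡m) (n<1+n m))))

open _≅_

≅-sym : ∀ {G H} → G ≅ H → H ≅ G
≅-sym {G} {H} φ = record
  { to = from φ ; from = to φ ; from-to = to-from φ ; to-from = from-to φ
  ; arc-pres = λ u v → trans (cong₂ (arc H) (sym (to-from φ u)) (sym (to-from φ v)))
                             (sym (arc-pres φ (from φ u) (from φ v))) }

≅-trans : ∀ {G H K} → G ≅ H → H ≅ K → G ≅ K
≅-trans φ ψ = record
  { to = λ v → to ψ (to φ v) ; from = λ v → from φ (from ψ v)
  ; from-to = λ v → trans (cong (from φ) (from-to ψ (to φ v))) (from-to φ v)
  ; to-from = λ v → trans (cong (to ψ) (to-from φ (from ψ v))) (to-from ψ v)
  ; arc-pres = λ u v → trans (arc-pres φ u v) (arc-pres ψ _ _) }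

to-injective : ∀ {G H} (φ : G ≅ H) → Injective _≡_ _≡_ (to φ)
to-injective φ {u} {v} same = trans (sym (from-to φ u)) (trans (cong (from φ) same) (from-to φ v))

arc-to : ∀ {G H} (φ : G ≅ H) {u v} → Arc G u v → Arc H (to φ u) (to φ v)
arc-to φ {u} {v} = subst T (arc-pres φ u v)

arc-from : ∀ {G H} (φ : G ≅ H) {u v} → Arc H (to φ u) (to φ v) → Arc G u v
arc-from φ {u} {v} = subst T (sym (arc-pres φ u v))

TransitiveTournament : Digraph → Set
TransitiveTournament G = IsTournament G × IsTransitive G

arc⇒≢ : ∀ {G u v} → Arc G u v → u ≢ v
arc⇒≢ {G} {u} uv refl = ≡false⇒¬T (loopless G u) uv

asymmetric : ∀ {G} → IsTournament G → ∀ {u v} → Arc G u v → ¬ Arc G v u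
asymmetric {G} tour {u} {v} uv vu with tour u v (arc⇒≢ {G} uv)
... | inj₁ (_ , ¬vu) = ¬vu vu
... | inj₂ (_ , ¬uv) = ¬uv uv

TT-transport : ∀ {G H} → G ≅ H → TransitiveTournament H → TransitiveTournament G
TT-transport {G} φ (tour , transitive) = tour' , transitive'
  where
  tour' : IsTournament G
  tour' u v u≢v with tour (to φ u) (to φ v) (λ same → u≢v (to-injective φ same))
  ... | inj₁ (uv , ¬vu) = inj₁ (arc-from φ uv , λ vu → ¬vu (arc-to φ vu))
  ... | inj₂ (vu , ¬uv) = inj₂ (arc-from φ vu , λ uv → ¬uv (arc-to φ uv))
  transitive' : IsTransitive G
  transitive' u v w uv vw u≢w =
    arc-from φ (transitive _ _ _ (arc-to φ uv) (arc-to φ vw) (λ same → u≢w (to-injective φ same)))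

RankedBy : (G : Digraph) → (Vtx G → ℕ) → Set
RankedBy G r = ∀ u v → arc G u v ≡ (r v <ᵇ r u)

ranked⇒TT : ∀ {G} (r : Vtx G → ℕ) → Injective _≡_ _≡_ r → RankedBy G r → TransitiveTournament G
ranked⇒TT {G} r r-injective arc≡ = tour , transitive
  where
  down : ∀ {u v} → Arc G u v → r v < r u
  down {u} {v} uv = <ᵇ⇒< (r v) (r u) (subst T (arc≡ u v) uv)
  up : ∀ {u v} → r v < r u → Arc G u v
  up {u} {v} rv<ru = subst T (sym (arc≡ u v)) (<⇒<ᵇ rv<ru)
  tour : IsTournament G
  tour u v u≢v with <-cmp (r u) (r v)
  ... | tri< ru<rv _ _ = inj₂ (up ru<rv , λ uv → <-asym ru<rv (down uv))
  ... | tri≈ _ same _  = ⊥-elim (u≢v (r-injective same))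
  ... | tri> _ _ rv<ru = inj₁ (up rv<ru , λ vu → <-asym rv<ru (down vu))
  transitive : IsTransitive G
  transitive u v w uv vw _ = up (<-trans (down vw) (down uv))

arcs-descend⇒ranked : ∀ {G} → IsTournament G → (r : Vtx G → ℕ) →
  (∀ {u v} → Arc G u v → r v < r u) → RankedBy G r
arcs-descend⇒ranked {G} tour r down u v = T-ext (λ uv → <⇒<ᵇ (down uv)) up
  where
  up : T (r v <ᵇ r u) → Arc G u v
  up lt with tour u v (λ { refl → <-irrefl refl (<ᵇ⇒< (r u) (r u) lt) })
  ... | inj₁ (uv , _) = uv
  ... | inj₂ (vu , _) = ⊥-elim (<-asym (down vu) (<ᵇ⇒< (r v) (r u) lt))

descents-are-arcs⇒ranked : ∀ {G} → IsTournament G → (r : Vtx G → ℕ) → Injective _≡_ _≡_ r →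
  (∀ {u v} → r v < r u → Arc G u v) → RankedBy G r
descents-are-arcs⇒ranked {G} tour r r-injective up u v = T-ext down (λ lt → up (<ᵇ⇒< (r v) (r u) lt))
  where
  down : Arc G u v → T (r v <ᵇ r u)
  down uv with <-cmp (r v) (r u)
  ... | tri< rv<ru _ _ = <⇒<ᵇ rv<ru
  ... | tri≈ _ same _  = ⊥-elim (arc⇒≢ {G} uv (sym (r-injective same)))
  ... | tri> _ _ ru<rv = ⊥-elim (asymmetric {G} tour uv (up ru<rv))

-- Conversely, a transitive tournament is ranked by outdegree: each vertex beats
-- exactly the vertices of smaller outdegree, and the outdegrees are 0, ..., n-1.
module Ranking {G : Digraph} (isTT : TransitiveTournament G) where

  outdegree-decreases : ∀ {u v} → Arc G u v → outdegree G v < outdegree G u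
  outdegree-decreases {u} {v} uv =
    subst₂ _<_ (sym (outdegree≡count G v)) (sym (outdegree≡count G u))
      (count-strict v⊆u v uv (≡false⇒¬T (loopless G v)))
    where
    -- by transitivity u beats everything v beats, and v itself
    v⊆u : ∀ w → Arc G v w → Arc G u w
    v⊆u w vw = proj₂ isTT u v w uv vw (λ { refl → asymmetric {G} (proj₁ isTT) uv vw })

  outdegree-injective : ∀ {u v} → outdegree G u ≡ outdegree G v → u ≡ v
  outdegree-injective {u} {v} same with u F.≟ v
  ... | yes u≡v = u≡v
  ... | no u≢v with proj₁ isTT u v u≢v
  ... | inj₁ (uv , _) = ⊥-elim (<-irrefl (sym same) (outdegree-decreases uv))
  ... | inj₂ (vu , _) = ⊥-elim (<-irrefl same (outdegree-decreases vu))

  outdegree-bounded : ∀ v → outdegree G v < size G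
  outdegree-bounded v = subst₂ _<_ (sym (outdegree≡count G v)) (count-all (size G))
    (count-strict (λ _ _ → tt) v tt (≡false⇒¬T (loopless G v)))

  arc≡outdegree< : RankedBy G (outdegree G)
  arc≡outdegree< = arcs-descend⇒ranked {G} (proj₁ isTT) (outdegree G) outdegree-decreases

  -- outdegrees as elements of Fin n; injective, hence a bijection
  rank : Vtx G → Fin (size G)
  rank v = fromℕ< (outdegree-bounded v)

  toℕ-rank : ∀ v → toℕ (rank v) ≡ outdegree G v
  toℕ-rank v = F.toℕ-fromℕ< (outdegree-bounded v)

  rank-injective : Injective _≡_ _≡_ rank
  rank-injective {u} {v} same =
    outdegree-injective (trans (sym (toℕ-rank u)) (trans (cong toℕ same) (toℕ-rank v)))

  vertex-of-rank : Fin (size G) → Vtx G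
  vertex-of-rank y = proj₁ (injective⇒surjective rank rank-injective y)

  rank-vertex-of-rank : ∀ y → rank (vertex-of-rank y) ≡ y
  rank-vertex-of-rank y = proj₂ (injective⇒surjective rank rank-injective y)

  outdegree-vertex-of-rank : ∀ y → outdegree G (vertex-of-rank y) ≡ toℕ y
  outdegree-vertex-of-rank y = trans (sym (toℕ-rank _)) (cong toℕ (rank-vertex-of-rank y))

Desc : ℕ → Digraph
Desc n = record
  { size = n ; arc = λ i j → toℕ j <ᵇ toℕ i
  ; loopless = λ i → ¬T⇒≡false (λ i<i → <-irrefl refl (<ᵇ⇒< (toℕ i) (toℕ i) i<i)) }

TT⇒Desc : ∀ {G} → TransitiveTournament G → G ≅ Desc (size G)
TT⇒Desc {G} isTT = record
  { to = rank ; from = vertex-of-rank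
  ; from-to = left-inverse⇒right-inverse vertex-of-rank rank rank-vertex-of-rank
  ; to-from = rank-vertex-of-rank
  ; arc-pres = λ u v → trans (arc≡outdegree< u v) (sym (cong₂ _<ᵇ_ (toℕ-rank v) (toℕ-rank u))) }
  where open Ranking {G} isTT

TT-unique : ∀ {G H} → TransitiveTournament G → TransitiveTournament H → size G ≡ size H → G ≅ H
TT-unique {G} {H} ttG ttH same =
  ≅-trans (TT⇒Desc ttG) (subst (λ k → Desc k ≅ H) (sym same) (≅-sym (TT⇒Desc ttH)))

-- Transitive tournaments have no directed cycles: the outdegree strictly
-- decreases along every arc, so it cannot return to its starting value.
TT⇒acyclic : ∀ {G} → TransitiveTournament G → IsAcyclic G
TT⇒acyclic {G} isTT (k , c , _ , steps , closing) =
  <-irrefl refl (begin-strict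
    g 0                             ≡⟨ cong (outdegree G) (at-toℕ {d = c zero} {s = c} zero) ⟩
    outdegree G (c zero)            <⟨ outdegree-decreases closing ⟩
    outdegree G (c (fromℕ (suc k))) ≡⟨ cong (outdegree G) (sym last) ⟩
    g (suc k)                       ≤⟨ m≤m+n (g (suc k)) (suc k) ⟩
    g (suc k) + suc k               ≤⟨ descent g descending 0 (suc k) (n<1+n (suc k)) ⟩
    g 0                             ∎)
  where
  open Ranking {G} isTT
  open ≤-Reasoning
  g : ℕ → ℕ
  g m = outdegree G (at (c zero) c m)
  descending : Descending (suc (suc k)) g
  descending a sa<n = outdegree-decreases (consecutive-at {R = Arc G} steps a sa<n)
  last : at (c zero) c (suc k) ≡ c (fromℕ (suc k))
  last = subst (λ m → at (c zero) c m ≡ c (fromℕ (suc k))) (F.toℕ-fromℕ (suc k))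
    (at-toℕ {d = c zero} {s = c} (fromℕ (suc k)))

triple : ∀ {A : Set} → A → A → A → Fin 3 → A
triple u v w zero             = u
triple u v w (suc zero)       = v
triple u v w (suc (suc zero)) = w

triple-injective : ∀ {A : Set} {u v w : A} → u ≢ v → v ≢ w → w ≢ u → Injective _≡_ _≡_ (triple u v w)
triple-injective u≢v v≢w w≢u {zero}             {zero}             _ = refl
triple-injective u≢v v≢w w≢u {zero}             {suc zero}         e = ⊥-elim (u≢v e)
triple-injective u≢v v≢w w≢u {zero}             {suc (suc zero)}   e = ⊥-elim (w≢u (sym e))
triple-injective u≢v v≢w w≢u {suc zero}         {zero}             e = ⊥-elim (u≢v (sym e))
triple-injective u≢v v≢w w≢u {suc zero}         {suc zero}         _ = refl
triple-injective u≢v v≢w w≢u {suc zero}         {suc (suc zero)}   e = ⊥-elim (v≢w e)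
triple-injective u≢v v≢w w≢u {suc (suc zero)}   {zero}             e = ⊥-elim (w≢u e)
triple-injective u≢v v≢w w≢u {suc (suc zero)}   {suc zero}         e = ⊥-elim (v≢w (sym e))
triple-injective u≢v v≢w w≢u {suc (suc zero)}   {suc (suc zero)}   _ = refl

TriangleFree : Digraph → Set
TriangleFree G = ∀ u v w → Arc G u v → Arc G v w → ¬ Arc G w u

triangle-free⇒transitive : ∀ {G} → IsTournament G → TriangleFree G → IsTransitive G
triangle-free⇒transitive tour no-triangle u v w uv vw u≢w with tour u w u≢w
... | inj₁ (uw , _) = uw
... | inj₂ (wu , _) = ⊥-elim (no-triangle u v w uv vw wu)

TT⇒triangle-free : ∀ {G} → TransitiveTournament G → TriangleFree G
TT⇒triangle-free {G} (tour , transitive) u v w uv vw wu =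
  asymmetric {G} tour (transitive u v w uv vw (λ u≡w → arc⇒≢ {G} wu (sym u≡w))) wu

triangle⇒cycle : ∀ {G u v w} → Arc G u v → Arc G v w → Arc G w u → DirectedCycle G
triangle⇒cycle {G} {u} {v} {w} uv vw wu =
  1 , triple u v w , triple-injective (arc⇒≢ {G} uv) (arc⇒≢ {G} vw) (arc⇒≢ {G} wu) , steps , wu
  where
  steps : Consecutive (Arc G) (triple u v w)
  steps zero             (suc zero)       _ = uv
  steps (suc zero)       (suc (suc zero)) _ = vw
  steps zero             zero             ()
  steps zero             (suc (suc zero)) ()
  steps (suc zero)       zero             ()
  steps (suc zero)       (suc zero)       ()
  steps (suc (suc zero)) zero             ()
  steps (suc (suc zero)) (suc zero)       ()
  steps (suc (suc zero)) (suc (suc zero)) ()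

-- In a tournament a directed triangle is an induced copy of C3, since the
-- reverse arcs are absent.
triangle⇒C3 : ∀ {G u v w} → IsTournament G → Arc G u v → Arc G v w → Arc G w u → InducedSub C3 G
triangle⇒C3 {G} {u} {v} {w} tour uv vw wu =
  triple u v w , triple-injective (arc⇒≢ {G} uv) (arc⇒≢ {G} vw) (arc⇒≢ {G} wu) , same-arcs
  where
  absent : ∀ {x y} → Arc G y x → false ≡ arc G x y
  absent yx = sym (¬T⇒≡false (asymmetric {G} tour yx))
  present : ∀ {x y} → Arc G x y → true ≡ arc G x y
  present xy = sym (T⇒≡true xy)
  same-arcs : ∀ i j → arc C3 i j ≡ arc G (triple u v w i) (triple u v w j)
  same-arcs zero             zero             = sym (loopless G u)
  same-arcs zero             (suc zero)       = present uv
  same-arcs zero             (suc (suc zero)) = absent wu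
  same-arcs (suc zero)       zero             = absent uv
  same-arcs (suc zero)       (suc zero)       = sym (loopless G v)
  same-arcs (suc zero)       (suc (suc zero)) = present vw
  same-arcs (suc (suc zero)) zero             = present wu
  same-arcs (suc (suc zero)) (suc zero)       = absent vw
  same-arcs (suc (suc zero)) (suc (suc zero)) = sym (loopless G w)

triangle-free⇒C3-free : ∀ {G} → TriangleFree G → ¬ InducedSub C3 G
triangle-free⇒C3-free {G} no-triangle (f , _ , same-arcs) =
  no-triangle (f zero) (f (suc zero)) (f (suc (suc zero)))
    (≡true⇒T (sym (same-arcs zero (suc zero))))
    (≡true⇒T (sym (same-arcs (suc zero) (suc (suc zero)))))
    (≡true⇒T (sym (same-arcs (suc (suc zero)) zero)))

pair : ∀ {A : Set} → A → A → Fin 2 → A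
pair u v zero       = u
pair u v (suc zero) = v

pair-injective : ∀ {A : Set} {u v : A} → u ≢ v → Injective _≡_ _≡_ (pair u v)
pair-injective u≢v {zero}     {zero}     _ = refl
pair-injective u≢v {zero}     {suc zero} e = ⊥-elim (u≢v e)
pair-injective u≢v {suc zero} {zero}     e = ⊥-elim (u≢v (sym e))
pair-injective u≢v {suc zero} {suc zero} _ = refl

pair-arcs : ∀ {G u v} (a : Fin 2 → Fin 2 → Bool) → a zero zero ≡ false → a (suc zero) (suc zero) ≡ false →
  a zero (suc zero) ≡ arc G u v → a (suc zero) zero ≡ arc G v u →
  ∀ i j → a i j ≡ arc G (pair u v i) (pair u v j)
pair-arcs {G} {u} {v} a a00 a11 a01 a10 zero       zero       = trans a00 (sym (loopless G u))
pair-arcs {G} {u} {v} a a00 a11 a01 a10 zero       (suc zero) = a01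
pair-arcs {G} {u} {v} a a00 a11 a01 a10 (suc zero) zero       = a10
pair-arcs {G} {u} {v} a a00 a11 a01 a10 (suc zero) (suc zero) = trans a11 (sym (loopless G v))

tournament⇒no-2K1 : ∀ {G} → IsTournament G → ¬ InducedSub twoK1 G
tournament⇒no-2K1 {G} tour (f , f-injective , same-arcs)
  with tour (f zero) (f (suc zero)) (λ same → 0≢1 (f-injective same))
  where
  0≢1 : zero ≢ suc zero
  0≢1 ()
... | inj₁ (uv , _) = ≡false⇒¬T (sym (same-arcs zero (suc zero))) uv
... | inj₂ (vu , _) = ≡false⇒¬T (sym (same-arcs (suc zero) zero)) vu

tournament⇒no-biK2 : ∀ {G} → IsTournament G → ¬ InducedSub biK2 G
tournament⇒no-biK2 {G} tour (f , _ , same-arcs) =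
  asymmetric {G} tour (≡true⇒T (sym (same-arcs zero (suc zero)))) (≡true⇒T (sym (same-arcs (suc zero) zero)))

no-2K1-biK2⇒tournament : ∀ {G} → ¬ InducedSub twoK1 G → ¬ InducedSub biK2 G → IsTournament G
no-2K1-biK2⇒tournament {G} no-2K1 no-biK2 u v u≢v with arc G u v in uv | arc G v u in vu
... | true  | false = inj₁ (tt , λ ())
... | false | true  = inj₂ (tt , λ ())
... | true  | true  = ⊥-elim (no-biK2 (pair u v , pair-injective u≢v , pair-arcs {G} (arc biK2) refl refl (sym uv) (sym vu)))
... | false | false = ⊥-elim (no-2K1 (pair u v , pair-injective u≢v , pair-arcs {G} (arc twoK1) refl refl (sym uv) (sym vu)))

TT⇒outdegrees : ∀ {G} → TransitiveTournament G → OutdegreesAll G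
TT⇒outdegrees {G} isTT = outdegree-bounded , λ k k<n →
  vertex-of-rank (fromℕ< k<n) , trans (outdegree-vertex-of-rank _) (F.toℕ-fromℕ< k<n)
  where open Ranking {G} isTT

-- Conversely, in a tournament with outdegrees 0, ..., n-1 every vertex beats all
-- vertices of smaller outdegree.  This is shown downwards from the top outdegree:
-- if all vertices above x beat everything below them, then every out-neighbour of x
-- lies below x, and since x has exactly as many out-neighbours as there are
-- vertices below it, x beats all of them.
module DistinctOutdegrees {G : Digraph} (tour : IsTournament G) (distinct : OutdegreesAll G) where

  d : Vtx G → ℕ
  d = outdegree G

  -- outdegrees as elements of Fin n, with the inverse given by the covering property
  rank : Vtx G → Fin (size G)
  rank v = fromℕ< (proj₁ distinct v)

  toℕ-rank : ∀ v → toℕ (rank v) ≡ d v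
  toℕ-rank v = F.toℕ-fromℕ< (proj₁ distinct v)

  vertex-of : Fin (size G) → Vtx G
  vertex-of y = proj₁ (proj₂ distinct (toℕ y) (F.toℕ<n y))

  rank-vertex-of : ∀ y → rank (vertex-of y) ≡ y
  rank-vertex-of y = F.toℕ-injective (trans (toℕ-rank _) (proj₂ (proj₂ distinct (toℕ y) (F.toℕ<n y))))

  vertex-of-rank : ∀ v → vertex-of (rank v) ≡ v
  vertex-of-rank = left-inverse⇒right-inverse vertex-of rank rank-vertex-of

  d-injective : Injective _≡_ _≡_ d
  d-injective {u} {v} same = trans (sym (vertex-of-rank u))
    (trans (cong vertex-of (F.toℕ-injective (trans (toℕ-rank u) (trans same (sym (toℕ-rank v))))))
      (vertex-of-rank v))

  BeatsLower : Vtx G → Set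
  BeatsLower x = ∀ z → d z < d x → Arc G x z

  -- exactly d x vertices lie below x, as d is a bijection onto 0, ..., n-1
  count-lower : ∀ x → count (λ z → d z <ᵇ d x) ≡ d x
  count-lower x = begin
    count (λ z → d z <ᵇ d x)                      ≡⟨ count-cong (λ z → cong (_<ᵇ d x) (sym (toℕ-rank z))) ⟩
    count (λ z → toℕ (rank z) <ᵇ d x)             ≡⟨ count-permute (λ y → toℕ y <ᵇ d x) rank vertex-of
                                                       rank-vertex-of vertex-of-rank ⟩
    count (λ (y : Fin (size G)) → toℕ y <ᵇ d x)   ≡⟨ count-below (size G) (d x) (<⇒≤ (proj₁ distinct x)) ⟩
    d x                                           ∎
    where open ≡-Reasoning

  beats-lower-step : ∀ x → (∀ y → d x < d y → BeatsLower y) → BeatsLower x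
  beats-lower-step x above z dz<dx =
    count-≡⇒⊇ out⊆lower (trans (sym (outdegree≡count G x)) (sym (count-lower x))) z (<⇒<ᵇ dz<dx)
    where
    out⊆lower : ∀ z → Arc G x z → T (d z <ᵇ d x)
    out⊆lower z xz with <-cmp (d z) (d x)
    ... | tri< dz<dx _ _ = <⇒<ᵇ dz<dx
    ... | tri≈ _ same _  = ⊥-elim (arc⇒≢ {G} xz (sym (d-injective same)))
    ... | tri> _ _ dx<dz = ⊥-elim (asymmetric {G} tour xz (above z dx<dz x dx<dz))

  beats-lower : ∀ x → BeatsLower x
  beats-lower x = <-rec (λ k → ∀ x → size G ∸ d x ≡ k → BeatsLower x) downward (size G ∸ d x) x refl
    where
    downward : ∀ k → (∀ {j} → j < k → ∀ y → size G ∸ d y ≡ j → BeatsLower y) → ∀ x → size G ∸ d x ≡ k → BeatsLower x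
    downward k rec x refl = beats-lower-step x λ y dx<dy →
      rec (∸-monoʳ-< dx<dy (<⇒≤ (proj₁ distinct y))) y refl

  arc≡outdegree< : RankedBy G d
  arc≡outdegree< = descents-are-arcs⇒ranked {G} tour d d-injective (λ {u} {v} → beats-lower u v)

outdegrees⇒TT : ∀ {G} → IsTournament G → OutdegreesAll G → TransitiveTournament G
outdegrees⇒TT {G} tour distinct = ranked⇒TT {G} (outdegree G) d-injective arc≡outdegree<
  where open DistinctOutdegrees {G} tour distinct

-- Along a Hamiltonian path of a transitive tournament the outdegrees strictly
-- decrease, so they are n-1, n-2, ..., 0.
ham-path-outdegrees : ∀ {G} → TransitiveTournament G → ∀ {q} → HamPath G q →
  ∀ i → outdegree G (q i) ≡ size G ∸ suc (toℕ i)
ham-path-outdegrees {G} isTT {q} (_ , steps) i =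
  trans (cong (outdegree G) (sym (at-toℕ {d = q i} i)))
    (descending-exact (size G) g descending (λ _ _ → outdegree-bounded _) (toℕ i) (F.toℕ<n i))
  where
  open Ranking {G} isTT
  g : ℕ → ℕ
  g m = outdegree G (at (q i) q m)
  descending : Descending (size G) g
  descending a sa<n = outdegree-decreases (consecutive-at {R = Arc G} steps a sa<n)

-- A transitive tournament has exactly one Hamiltonian path: the vertices in
-- order of decreasing outdegree.
TT⇒unique-ham-path : ∀ {G} → TransitiveTournament G → ExactlyOneHamPath G
TT⇒unique-ham-path {G} isTT = p , (p-injective , p-steps) , unique
  where
  open Ranking {G} isTT
  p : Fin (size G) → Vtx G
  p i = vertex-of-rank (opposite i)
  outdegree-p : ∀ i → outdegree G (p i) ≡ size G ∸ suc (toℕ i)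
  outdegree-p i = trans (outdegree-vertex-of-rank (opposite i)) (F.opposite-prop i)
  p-injective : Injective _≡_ _≡_ p
  p-injective same =
    opposite-injective (trans (sym (rank-vertex-of-rank _)) (trans (cong rank same) (rank-vertex-of-rank _)))
  p-steps : Consecutive (Arc G) p
  p-steps i j j≡1+i = subst T (sym (arc≡outdegree< (p i) (p j)))
    (<⇒<ᵇ (subst₂ _<_ (sym (outdegree-vertex-of-rank (opposite j))) (sym (outdegree-vertex-of-rank (opposite i)))
      (opposite-antitone (≤-reflexive (sym j≡1+i)))))
  unique : ∀ q → HamPath G q → ∀ i → q i ≡ p i
  unique q path i = outdegree-injective (trans (ham-path-outdegrees {G} isTT path i) (sym (outdegree-p i)))

-- Positions 0, ..., k after moving the entry at position i < k to position k:
-- the new position m holds the old entry rotate i k m, i.e. the sequence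
-- becomes 0, ..., i-1, i+1, ..., k, i, k+1, ...
rotate : ℕ → ℕ → ℕ → ℕ
rotate i k m with m <? i
... | yes _ = m
... | no _ with m <? k
... | yes _ = suc m
... | no _ with m ≟ k
... | yes _ = i
... | no _ = m

rotate-below : ∀ {i k m} → m < i → rotate i k m ≡ m
rotate-below {i} {k} {m} lt with m <? i
... | yes _ = refl
... | no ¬p = ⊥-elim (¬p lt)

rotate-inside : ∀ {i k m} → i ≤ m → m < k → rotate i k m ≡ suc m
rotate-inside {i} {k} {m} le lt with m <? i
... | yes p = ⊥-elim (<⇒≱ p le)
... | no _ with m <? k
... | yes _ = refl
... | no ¬p = ⊥-elim (¬p lt)

rotate-end : ∀ {i k} → i < k → rotate i k k ≡ i
rotate-end {i} {k} ik with k <? i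
... | yes p = ⊥-elim (<-asym p ik)
... | no _ with k <? k
... | yes p = ⊥-elim (<-irrefl refl p)
... | no _ with k ≟ k
... | yes _ = refl
... | no ¬p = ⊥-elim (¬p refl)

rotate-above : ∀ {i k m} → i < k → k < m → rotate i k m ≡ m
rotate-above {i} {k} {m} ik km with m <? i
... | yes _ = refl
... | no _ with m <? k
... | yes p = ⊥-elim (<-asym p km)
... | no _ with m ≟ k
... | yes refl = ⊥-elim (<-irrefl refl km)
... | no _ = refl

-- The inverse of rotate i k; it shows that the rotated sequence is injective.
unrotate : ℕ → ℕ → ℕ → ℕ
unrotate i k b with b <? i
... | yes _ = b
... | no _ with b ≟ i
... | yes _ = k
... | no _ with b ≤? k
... | yes _ = pred b
... | no _ = b

unrotate-below : ∀ {i k b} → b < i → unrotate i k b ≡ b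
unrotate-below {i} {k} {b} lt with b <? i
... | yes _ = refl
... | no ¬p = ⊥-elim (¬p lt)

unrotate-start : ∀ {i k} → unrotate i k i ≡ k
unrotate-start {i} {k} with i <? i
... | yes p = ⊥-elim (<-irrefl refl p)
... | no _ with i ≟ i
... | yes _ = refl
... | no ¬p = ⊥-elim (¬p refl)

unrotate-inside : ∀ {i k b} → i < b → b ≤ k → unrotate i k b ≡ pred b
unrotate-inside {i} {k} {b} ib bk with b <? i
... | yes p = ⊥-elim (<-asym p ib)
... | no _ with b ≟ i
... | yes refl = ⊥-elim (<-irrefl refl ib)
... | no _ with b ≤? k
... | yes _ = refl
... | no ¬p = ⊥-elim (¬p bk)

unrotate-above : ∀ {i k b} → i < k → k < b → unrotate i k b ≡ b
unrotate-above {i} {k} {b} ik kb with b <? i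
... | yes _ = refl
... | no _ with b ≟ i
... | yes refl = ⊥-elim (<-asym ik kb)
... | no _ with b ≤? k
... | yes p = ⊥-elim (<⇒≱ kb p)
... | no _ = refl

unrotate-rotate : ∀ {i k} → i < k → ∀ a → unrotate i k (rotate i k a) ≡ a
unrotate-rotate {i} {k} ik a with <-cmp a i
... | tri< a<i _ _ = trans (cong (unrotate i k) (rotate-below a<i)) (unrotate-below a<i)
... | tri≈ _ refl _ = trans (cong (unrotate i k) (rotate-inside ≤-refl ik)) (unrotate-inside (s≤s ≤-refl) ik)
... | tri> _ _ i<a with <-cmp a k
...   | tri< a<k _ _ = trans (cong (unrotate i k) (rotate-inside (<⇒≤ i<a) a<k)) (unrotate-inside (s≤s (<⇒≤ i<a)) a<k)
...   | tri≈ _ refl _ = trans (cong (unrotate i k) (rotate-end ik)) (unrotate-start {i} {k})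
...   | tri> _ _ k<a = trans (cong (unrotate i k) (rotate-above ik k<a)) (unrotate-above ik k<a)

rotate-bounded : ∀ {i k n} → i < k → k < n → ∀ a → a < n → rotate i k a < n
rotate-bounded {i} {k} {n} ik kn a an with <-cmp a i
... | tri< a<i _ _ = subst (_< n) (sym (rotate-below a<i)) an
... | tri≈ _ refl _ = subst (_< n) (sym (rotate-inside ≤-refl ik)) (≤-trans (s≤s ik) kn)
... | tri> _ _ i<a with <-cmp a k
...   | tri< a<k _ _ = subst (_< n) (sym (rotate-inside (<⇒≤ i<a) a<k)) (≤-trans (s≤s a<k) kn)
...   | tri≈ _ refl _ = subst (_< n) (sym (rotate-end ik)) (<-trans ik kn)
...   | tri> _ _ k<a = subst (_< n) (sym (rotate-above ik k<a)) an


-- Conversely, in a tournament with a unique Hamiltonian path p every arc points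
-- forward along p.  Otherwise take the first position i with a backward arc into
-- it and the last position k with p k → p i; then moving p i to just after p k
-- gives a second Hamiltonian path
--   p 0, ..., p (i-1), p (i+1), ..., p k, p i, p (k+1), ...
module UniqueHamPath {G : Digraph} (tour : IsTournament G) {p : Fin (size G) → Vtx G} (path : HamPath G p)
  (unique : ∀ q → HamPath G q → ∀ i → q i ≡ p i) (nonempty : 0 < size G) where

  n : ℕ
  n = size G

  P : ℕ → Vtx G
  P = at (p (fromℕ< nonempty)) p

  P-injective : ∀ {a b} → a < n → b < n → P a ≡ P b → a ≡ b
  P-injective = at-injective (proj₁ path)

  P-step : ∀ a → suc a < n → Arc G (P a) (P (suc a))
  P-step = consecutive-at {R = Arc G} (proj₂ path)

  Forward : ℕ → Set
  Forward i = ∀ j → i < j → j < n → Arc G (P i) (P j)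

  second-path : ∀ i k → i < k → k < n → Arc G (P k) (P i) → (∀ j → k < j → j < n → Arc G (P i) (P j)) →
    (∀ i' → i' < i → Forward i') → ⊥
  second-path i k i<k k<n back after earlier = <-irrefl (sym (P-injective i+1<n i<n moved-entry)) (n<1+n i)
    where
    i<n = <-trans i<k k<n
    i+1<n = ≤-trans (s≤s i<k) k<n
    Q : Fin n → Vtx G
    Q x = P (rotate i k (toℕ x))
    Q-injective : Injective _≡_ _≡_ Q
    Q-injective {x} {y} same = F.toℕ-injective (trans (sym (unrotate-rotate i<k (toℕ x)))
      (trans (cong (unrotate i k) (P-injective (rotate-bounded i<k k<n _ (F.toℕ<n x))
                                               (rotate-bounded i<k k<n _ (F.toℕ<n y)) same))
        (unrotate-rotate i<k (toℕ y))))
    rotated-step : ∀ a → suc a < n → Arc G (P (rotate i k a)) (P (rotate i k (suc a)))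
    rotated-step a sa<n with <-cmp (suc a) i
    ... | tri< sa<i _ _ = subst₂ (λ x y → Arc G (P x) (P y))
            (sym (rotate-below (<-trans (n<1+n a) sa<i))) (sym (rotate-below sa<i)) (P-step a sa<n)
    ... | tri≈ _ refl _ = subst₂ (λ x y → Arc G (P x) (P y))
            (sym (rotate-below (n<1+n a))) (sym (rotate-inside ≤-refl i<k))
            (earlier a (n<1+n a) (suc (suc a)) (<-trans (n<1+n a) (n<1+n (suc a))) i+1<n)
    ... | tri> _ _ i<sa with <-cmp (suc a) k
    ...   | tri< sa<k _ _ = subst₂ (λ x y → Arc G (P x) (P y))
              (sym (rotate-inside (s≤s⁻¹ i<sa) (<-trans (n<1+n a) sa<k))) (sym (rotate-inside (<⇒≤ i<sa) sa<k))
              (P-step (suc a) (≤-trans (s≤s sa<k) k<n))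
    ...   | tri≈ _ refl _ = subst₂ (λ x y → Arc G (P x) (P y))
              (sym (rotate-inside (s≤s⁻¹ i<sa) (n<1+n a))) (sym (rotate-end i<k)) back
    ...   | tri> _ _ k<sa with m≤n⇒m<n∨m≡n (s≤s⁻¹ k<sa)
    ...     | inj₂ refl = subst₂ (λ x y → Arc G (P x) (P y))
                (sym (rotate-end i<k)) (sym (rotate-above i<k k<sa)) (after (suc a) k<sa sa<n)
    ...     | inj₁ k<a = subst₂ (λ x y → Arc G (P x) (P y))
                (sym (rotate-above i<k k<a)) (sym (rotate-above i<k k<sa)) (P-step a sa<n)
    Q-steps : Consecutive (Arc G) Q
    Q-steps x y y≡1+x = subst (λ t → Arc G (Q x) (P (rotate i k t))) (sym y≡1+x)
      (rotated-step (toℕ x) (subst (_< n) y≡1+x (F.toℕ<n y)))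
    -- by uniqueness Q agrees with p, yet it holds P (i+1) at position i
    moved-entry : P (suc i) ≡ P i
    moved-entry = begin
      P (suc i)                          ≡⟨ cong P (sym (rotate-inside ≤-refl i<k)) ⟩
      P (rotate i k i)                   ≡⟨ cong (λ t → P (rotate i k t)) (sym (F.toℕ-fromℕ< i<n)) ⟩
      Q (fromℕ< i<n)                     ≡⟨ unique Q (Q-injective , Q-steps) (fromℕ< i<n) ⟩
      p (fromℕ< i<n)                     ≡⟨ sym (at-fromℕ< i<n) ⟩
      P i                                ∎
      where open ≡-Reasoning

  -- position i is forward if all earlier ones are: shown for j by downward
  -- induction from the end of the path
  forward-step : ∀ i → i < n → (∀ i' → i' < i → Forward i') → Forward i
  forward-step i i<n earlier j i<j j<n = from-end n j (m≤n+m n j) i<j j<n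
    where
    from-end : ∀ fuel j → n ≤ j + fuel → i < j → j < n → Arc G (P i) (P j)
    from-end zero j n≤j i<j j<n = ⊥-elim (<⇒≱ j<n (subst (n ≤_) (+-identityʳ j) n≤j))
    from-end (suc fuel) j n≤j+sf i<j j<n with tour (P i) (P j) (λ same → <-irrefl (P-injective i<n j<n same) i<j)
    ... | inj₁ (ij , _) = ij
    ... | inj₂ (ji , _) = ⊥-elim (second-path i j i<j j<n ji later earlier)
      where
      later : ∀ j' → j < j' → j' < n → Arc G (P i) (P j')
      later j' j<j' j'<n = from-end fuel j' (≤-trans n≤j+sf (≤-trans (≤-reflexive (+-suc j fuel)) (+-monoˡ-≤ fuel j<j')))
        (<-trans i<j j<j') j'<n

  all-forward : ∀ i → i < n → Forward i
  all-forward = <-rec (λ i → i < n → Forward i) λ i earlier i<n →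
    forward-step i i<n (λ i' i'<i → earlier i'<i (<-trans i'<i i<n))

  forward : ∀ a b → toℕ a < toℕ b → Arc G (p a) (p b)
  forward a b a<b = subst₂ (Arc G) (at-toℕ a) (at-toℕ b) (all-forward (toℕ a) (F.toℕ<n a) (toℕ b) a<b (F.toℕ<n b))

  -- every vertex lies on p, and reversed positions rank G
  position : Vtx G → Fin n
  position v = proj₁ (injective⇒surjective p (proj₁ path) v)

  p-position : ∀ v → p (position v) ≡ v
  p-position v = proj₂ (injective⇒surjective p (proj₁ path) v)

  rank : Vtx G → ℕ
  rank v = toℕ (opposite (position v))

  rank-injective : Injective _≡_ _≡_ rank
  rank-injective {u} {v} same = trans (sym (p-position u))
    (trans (cong p (opposite-injective (F.toℕ-injective same))) (p-position v))

  arc≡rank< : RankedBy G rank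
  arc≡rank< = descents-are-arcs⇒ranked {G} tour rank rank-injective λ {u} {v} rv<ru →
    subst₂ (Arc G) (p-position u) (p-position v) (forward (position u) (position v) (opposite-reflects rv<ru))

unique-ham-path⇒TT : ∀ {G} → 0 < size G → IsTournament G → ExactlyOneHamPath G → TransitiveTournament G
unique-ham-path⇒TT {G} nonempty tour (p , path , unique) =
  ranked⇒TT {G} rank rank-injective arc≡rank<
  where open UniqueHamPath {G} tour path unique nonempty

any-allFin⁺ : ∀ {n} (f : Fin n → Bool) w → T (f w) → T (any f (allFin n))
any-allFin⁺ f w fw = any⁺ f (lose (∈-allFin w) fw)

any-allFin⁻ : ∀ {n} (f : Fin n → Bool) → T (any f (allFin n)) → ∃ λ w → T (f w)
any-allFin⁻ {n} f found = satisfied (any⁻ f (allFin n) found)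

reach-Pdir⇒ : ∀ {n} m (u v : Fin n) → T (reach (Pdir n) m u v) → toℕ u ≤ toℕ v × toℕ v ≤ toℕ u + m
reach-Pdir⇒ zero u v u=v with ==⇒≡ {u = u} {v} u=v
... | refl = ≤-refl , m≤m+n (toℕ u) 0
reach-Pdir⇒ {n} (suc m) u v r with ⇔.Equivalence.to T-∨ r
... | inj₁ within-m with reach-Pdir⇒ m u v within-m
...   | u≤v , v≤u+m = u≤v , ≤-trans v≤u+m (+-monoʳ-≤ (toℕ u) (n≤1+n m))
reach-Pdir⇒ {n} (suc m) u v r | inj₂ via
  with any-allFin⁻ (λ w → reach (Pdir n) m u w ∧ arc (Pdir n) w v) via
... | w , uw∧wv with ⇔.Equivalence.to T-∧ uw∧wv
... | uw , wv with reach-Pdir⇒ m u w uw | does⇒ (toℕ v ≟ suc (toℕ w)) wv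
... | u≤w , w≤u+m | v≡1+w =
  ≤-trans u≤w (≤-trans (n≤1+n (toℕ w)) (≤-reflexive (sym v≡1+w))) ,
  ≤-trans (≤-reflexive v≡1+w) (≤-trans (s≤s w≤u+m) (≤-reflexive (sym (+-suc (toℕ u) m))))

⇒reach-Pdir : ∀ {n} m (u v : Fin n) → toℕ u ≤ toℕ v → toℕ v ≤ toℕ u + m → T (reach (Pdir n) m u v)
⇒reach-Pdir zero u v u≤v v≤u+0 =
  ≡⇒== (F.toℕ-injective (≤-antisym u≤v (≤-trans v≤u+0 (≤-reflexive (+-identityʳ (toℕ u))))))
⇒reach-Pdir {n} (suc m) u v u≤v v≤u+sm with toℕ v ≤? toℕ u + m
... | yes v≤u+m = ⇔.Equivalence.from T-∨ (inj₁ (⇒reach-Pdir m u v u≤v v≤u+m))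
... | no  v≰u+m = ⇔.Equivalence.from T-∨ (inj₂ (last-step u v u≤v
        (≤-antisym v≤u+sm (≤-trans (≤-reflexive (+-suc (toℕ u) m)) (≰⇒> v≰u+m)))))
  where
  -- v is exactly m+1 steps after u: go m steps to its predecessor, then one more
  last-step : ∀ {n} (u v : Fin n) → toℕ u ≤ toℕ v → toℕ v ≡ toℕ u + suc m →
    T (any (λ w → reach (Pdir n) m u w ∧ arc (Pdir n) w v) (allFin n))
  last-step u zero _ v≡u+sm = ⊥-elim (0≢1+n (trans v≡u+sm (+-suc (toℕ u) m)))
  last-step {suc n} u (suc v') _ v≡u+sm = any-allFin⁺ _ (inject₁ v') (⇔.Equivalence.from T-∧
    (⇒reach-Pdir m u (inject₁ v') (≤-trans (m≤m+n (toℕ u) m) (≤-reflexive (sym v'≡u+m)))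
                                   (≤-reflexive v'≡u+m) ,
     ⇒does (suc (toℕ v') ≟ suc (toℕ (inject₁ v'))) (cong suc (sym (F.toℕ-inject₁ v')))))
    where
    v'≡u+m : toℕ (inject₁ v') ≡ toℕ u + m
    v'≡u+m = trans (F.toℕ-inject₁ v') (suc-injective (trans v≡u+sm (+-suc (toℕ u) m)))

power-Pdir-arc : ∀ n (u v : Fin n) → arc (power (Pdir n) (n ∸ 1)) u v ≡ (toℕ u <ᵇ toℕ v)
power-Pdir-arc n u v = T-ext forth back
  where
  u≢v⇒ : u ≢ v → T (not (u == v))
  u≢v⇒ u≢v = ⇔.Equivalence.from T-not-≡ (¬T⇒≡false (λ u=v → u≢v (==⇒≡ {u = u} {v} u=v)))
  forth : T (arc (power (Pdir n) (n ∸ 1)) u v) → T (toℕ u <ᵇ toℕ v)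
  forth uv with ⇔.Equivalence.to T-∧ uv
  ... | u≠v , r = <⇒<ᵇ (≤∧≢⇒< (proj₁ (reach-Pdir⇒ (n ∸ 1) u v r))
    (λ same → ≡false⇒¬T (⇔.Equivalence.to T-not-≡ u≠v) (≡⇒== {u = u} {v} (F.toℕ-injective same))))
  below-last : ∀ {m n} → m < n → m ≤ n ∸ 1
  below-last {n = suc n} (s≤s m≤n) = m≤n
  back : T (toℕ u <ᵇ toℕ v) → T (arc (power (Pdir n) (n ∸ 1)) u v)
  back lt = ⇔.Equivalence.from T-∧ (u≢v⇒ (λ u≡v → <-irrefl (cong toℕ u≡v) u<v) ,
    ⇒reach-Pdir (n ∸ 1) u v (<⇒≤ u<v) (≤-trans (below-last (F.toℕ<n v)) (m≤n+m (n ∸ 1) (toℕ u))))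
    where u<v = <ᵇ⇒< (toℕ u) (toℕ v) lt

power-Pdir-TT : ∀ n → TransitiveTournament (power (Pdir n) (n ∸ 1))
power-Pdir-TT n = ranked⇒TT {power (Pdir n) (n ∸ 1)} (λ u → toℕ (opposite u))
  (λ same → opposite-injective (F.toℕ-injective same))
  (λ u v → trans (power-Pdir-arc n u v) (sym (opposite-reverses u v)))

K1-TT : TransitiveTournament K1
K1-TT = ranked⇒TT {K1} toℕ F.toℕ-injective (λ { zero zero → refl })

K1OrPathPower : Digraph → Set
K1OrPathPower G = (G ≅ K1) ⊎ Σ ℕ (λ n → (2 ≤ n) × (G ≅ power (Pdir n) (n ∸ 1)))

TT⇒K1-or-power : ∀ {G} → 0 < size G → TransitiveTournament G → K1OrPathPower G
TT⇒K1-or-power {G} nonempty isTT = by-size (size G) refl nonempty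
  where
  by-size : ∀ k → size G ≡ k → 0 < k → K1OrPathPower G
  by-size 1             size≡1 _ = inj₁ (TT-unique isTT K1-TT size≡1)
  by-size (suc (suc k)) size≡k _ = inj₂ (size G , subst (2 ≤_) (sym size≡k) (s≤s (s≤s z≤n)) ,
    TT-unique isTT (power-Pdir-TT (size G)) refl)

K1-or-power⇒TT : ∀ {G} → K1OrPathPower G → TransitiveTournament G
K1-or-power⇒TT (inj₁ G≅K1)            = TT-transport G≅K1 K1-TT
K1-or-power⇒TT (inj₂ (n , _ , G≅Pⁿ)) = TT-transport G≅Pⁿ (power-Pdir-TT n)

OD-TT : ∀ {H} → TransitiveTournament H → TransitiveTournament (OD H)
OD-TT {H} (tour , transitive) = tour' , transitive'
  where
  tour' : IsTournament (OD H)
  tour' zero    zero    0≢0 = ⊥-elim (0≢0 refl)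
  tour' zero    (suc w) _   = inj₁ (tt , λ ())
  tour' (suc u) zero    _   = inj₂ (tt , λ ())
  tour' (suc u) (suc w) u≢w = tour u w (λ u≡w → u≢w (cong suc u≡w))
  transitive' : IsTransitive (OD H)
  transitive' zero    (suc v) (suc w) _  _  _   = tt
  transitive' (suc u) (suc v) (suc w) uv vw u≢w = transitive u v w uv vw (λ u≡w → u≢w (cong suc u≡w))
  transitive' zero    (suc v) zero    _  () _
  transitive' (suc u) (suc v) zero    _  () _
  transitive' zero    zero    _       () _  _
  transitive' (suc u) zero    _       () _  _

ID-TT : ∀ {H} → TransitiveTournament H → TransitiveTournament (ID H)
ID-TT {H} (tour , transitive) = tour' , transitive'
  where
  tour' : IsTournament (ID H)
  tour' zero    zero    0≢0 = ⊥-elim (0≢0 refl)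
  tour' zero    (suc w) _   = inj₂ (tt , λ ())
  tour' (suc u) zero    _   = inj₁ (tt , λ ())
  tour' (suc u) (suc w) u≢w = tour u w (λ u≡w → u≢w (cong suc u≡w))
  transitive' : IsTransitive (ID H)
  transitive' (suc u) (suc v) zero    _  _  _   = tt
  transitive' (suc u) (suc v) (suc w) uv vw u≢w = transitive u v w uv vw (λ u≡w → u≢w (cong suc u≡w))
  transitive' zero    zero    _       () _  _
  transitive' zero    (suc v) _       () _  _
  transitive' (suc u) zero    zero    _  () _
  transitive' (suc u) zero    (suc w) _  () _

Gen⇒TT : ∀ {o} → (∀ {H} → TransitiveTournament H → TransitiveTournament (o H)) →
  ∀ {H} → Gen o H → TransitiveTournament H
Gen⇒TT preserve base     = K1-TT
Gen⇒TT preserve (step g) = preserve (Gen⇒TT preserve g)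

InGen⇒TT : ∀ {o G} → (∀ {H} → TransitiveTournament H → TransitiveTournament (o H)) →
  InGen o G → TransitiveTournament G
InGen⇒TT preserve (H , g , G≅H) = TT-transport G≅H (Gen⇒TT preserve g)

-- ... and if o adds one vertex, it contains one of every positive size, hence
-- by uniqueness every nonempty transitive tournament.
generated-of-size : ∀ {o} → (∀ H → size (o H) ≡ suc (size H)) →
  ∀ k → Σ Digraph λ H → Gen o H × size H ≡ suc k
generated-of-size grows zero    = K1 , base , refl
generated-of-size grows (suc k) with generated-of-size grows k
... | H , g , size≡ = _ , step g , trans (grows H) (cong suc size≡)

TT⇒InGen : ∀ {o G} → (∀ H → size (o H) ≡ suc (size H)) →
  (∀ {H} → TransitiveTournament H → TransitiveTournament (o H)) →
  0 < size G → TransitiveTournament G → InGen o G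
TT⇒InGen {o} {G} grows preserve nonempty isTT with generated-of-size grows (pred (size G))
... | H , g , size≡ = H , g , TT-unique isTT (Gen⇒TT preserve g)
  (trans (sym (suc-pred (size G) {{>-nonZero nonempty}})) (sym size≡))

-- Equality of types as a plain case distinction: unlike a `with` on x F.≟ a it
-- leaves the boolean tests x == a occurring in goals untouched.
same-or-different : ∀ {t} (x a : Fin t) → x ≡ a ⊎ x ≢ a
same-or-different x a with x F.≟ a
... | yes x≡a = inj₁ x≡a
... | no  x≢a = inj₂ x≢a

occurrences : ∀ {t} → Fin t → List (Fin t) → ℕ
occurrences a xs = sum (map (λ x → indicator (x == a)) xs)

occurrences-single : ∀ {t} (a : Fin t) q → occ a (q ∷ []) ≡ occurrences a q
occurrences-single a q = cong (λ xs → occurrences a xs) (++-identityʳ q)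

occurrences-skip : ∀ {t} {a x : Fin t} xs → x ≢ a → occurrences a (x ∷ xs) ≡ occurrences a xs
occurrences-skip {a = a} {x} xs x≢a = cong (λ b → indicator b + occurrences a xs) (dec-false (x F.≟ a) x≢a)

occurrences-head : ∀ {t} {a : Fin t} xs → occurrences a (a ∷ xs) ≡ suc (occurrences a xs)
occurrences-head {a = a} xs = cong (λ b → indicator b + occurrences a xs) (dec-true (a F.≟ a) refl)

elem-∷⁻ : ∀ {t} {a x : Fin t} {xs} → T (elem a (x ∷ xs)) → x ≡ a ⊎ T (elem a xs)
elem-∷⁻ {a = a} {x} found with ⇔.Equivalence.to T-∨ found
... | inj₁ x=a  = inj₁ (==⇒≡ {u = x} {a} x=a)
... | inj₂ in-xs = inj₂ in-xs

elem-∷⁺ : ∀ {t} {a x : Fin t} {xs} → x ≡ a ⊎ T (elem a xs) → T (elem a (x ∷ xs))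
elem-∷⁺ {a = a} {x} (inj₁ x≡a) = ⇔.Equivalence.from T-∨ (inj₁ (≡⇒== {u = x} {a} x≡a))
elem-∷⁺                (inj₂ in-xs) = ⇔.Equivalence.from T-∨ (inj₂ in-xs)

elem⇒occurs : ∀ {t} {a : Fin t} xs → T (elem a xs) → 1 ≤ occurrences a xs
elem⇒occurs {a = a} (x ∷ xs) found with elem-∷⁻ {a = a} {x} {xs} found
... | inj₁ refl  = subst (1 ≤_) (sym (occurrences-head xs)) (s≤s z≤n)
... | inj₂ in-xs = ≤-trans (elem⇒occurs xs in-xs) (m≤n+m (occurrences a xs) (indicator (x == a)))

occurs⇒elem : ∀ {t} {a : Fin t} xs → 1 ≤ occurrences a xs → T (elem a xs)
occurs⇒elem {a = a} (x ∷ xs) occurs with x F.≟ a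
... | yes _ = tt
... | no  _ = occurs⇒elem xs occurs

before-∷⁻ : ∀ {t} {u v x : Fin t} {xs} → T (before u v (x ∷ xs)) → (x ≡ u × T (elem v xs)) ⊎ T (before u v xs)
before-∷⁻ {u = u} {v} {x} {xs} b with ⇔.Equivalence.to T-∨ b
... | inj₂ in-tail = inj₂ in-tail
... | inj₁ at-head with ⇔.Equivalence.to T-∧ at-head
... | x=u , v-later = inj₁ (==⇒≡ {u = x} {u} x=u , v-later)

before-∷⁺ : ∀ {t} {u v x : Fin t} {xs} → (x ≡ u × T (elem v xs)) ⊎ T (before u v xs) → T (before u v (x ∷ xs))
before-∷⁺ {u = u} {v} {x} (inj₁ (x≡u , v-later)) =
  ⇔.Equivalence.from T-∨ (inj₁ (⇔.Equivalence.from T-∧ (≡⇒== {u = x} {u} x≡u , v-later)))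
before-∷⁺ (inj₂ in-tail) = ⇔.Equivalence.from T-∨ (inj₂ in-tail)

before-skip : ∀ {t} {u v x : Fin t} {xs} → x ≢ u → T (before u v (x ∷ xs)) → T (before u v xs)
before-skip {xs = xs} x≢u b with before-∷⁻ {xs = xs} b
... | inj₁ (x≡u , _) = ⊥-elim (x≢u x≡u)
... | inj₂ in-tail   = in-tail

before⇒elem : ∀ {t} {u v : Fin t} xs → T (before u v xs) → T (elem u xs) × T (elem v xs)
before⇒elem {u = u} {v} (x ∷ xs) b with before-∷⁻ {u = u} {v} {x} {xs} b
... | inj₁ (x≡u , v-later) = elem-∷⁺ {a = u} {x} {xs} (inj₁ x≡u) , elem-∷⁺ {a = v} {x} {xs} (inj₂ v-later)
... | inj₂ in-tail with before⇒elem xs in-tail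
... | u∈ , v∈ = elem-∷⁺ {a = u} {x} {xs} (inj₂ u∈) , elem-∷⁺ {a = v} {x} {xs} (inj₂ v∈)

Ordered : ∀ {t} → Fin t → Fin t → List (Fin t) → Set
Ordered u v q = (T (before u v q) × ¬ T (before v u q)) ⊎ (T (before v u q) × ¬ T (before u v q))

ordered-swap : ∀ {t} {u v : Fin t} {q} → Ordered u v q → Ordered v u q
ordered-swap (inj₁ uv) = inj₂ uv
ordered-swap (inj₂ vu) = inj₁ vu

head-first : ∀ {t} {u v : Fin t} xs → u ≢ v → occurrences u (u ∷ xs) ≡ 1 → occurrences v (u ∷ xs) ≡ 1 →
  Ordered u v (u ∷ xs)
head-first {u = u} {v} xs u≢v once-u once-v =
  inj₁ (before-∷⁺ {xs = xs} (inj₁ (refl , v-later)) , v-not-first)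
  where
  v-later : T (elem v xs)
  v-later = occurs⇒elem xs (≤-reflexive (trans (sym once-v) (occurrences-skip xs u≢v)))
  no-u-later : ¬ T (elem u xs)
  no-u-later u-later = <-irrefl (sym (suc-injective (trans (sym (occurrences-head xs)) once-u)))
    (elem⇒occurs xs u-later)
  v-not-first : ¬ T (before v u (u ∷ xs))
  v-not-first b = no-u-later (proj₂ (before⇒elem xs (before-skip {xs = xs} (λ u≡v → u≢v u≡v) b)))

ordered : ∀ {t} {u v : Fin t} q → u ≢ v → occurrences u q ≡ 1 → occurrences v q ≡ 1 → Ordered u v q
ordered {u = u} {v} (x ∷ xs) u≢v once-u once-v with same-or-different x u | same-or-different x v
... | inj₁ refl | _         = head-first xs u≢v once-u once-v
... | inj₂ _    | inj₁ refl = ordered-swap {u = v} {u} {v ∷ xs} (head-first xs (λ v≡u → u≢v (sym v≡u)) once-v once-u)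
... | inj₂ x≢u  | inj₂ x≢v  with ordered xs u≢v (trans (sym (occurrences-skip xs x≢u)) once-u)
                                             (trans (sym (occurrences-skip xs x≢v)) once-v)
...   | inj₁ (uv , ¬vu) = inj₁ (before-∷⁺ {u = u} {v} {x} {xs} (inj₂ uv) ,
                                 λ vu → ¬vu (before-skip {u = v} {u} {x} {xs} x≢v vu))
...   | inj₂ (vu , ¬uv) = inj₂ (before-∷⁺ {u = v} {u} {x} {xs} (inj₂ vu) ,
                                 λ uv → ¬uv (before-skip {u = u} {v} {x} {xs} x≢u uv))

before-transitive : ∀ {t} {u v w : Fin t} q → occurrences v q ≤ 1 →
  T (before u v q) → T (before v w q) → T (before u w q)
before-transitive {u = u} {v} {w} (x ∷ xs) at-most-once uv vw
  with before-∷⁻ {u = u} {v} {x} {xs} uv | before-∷⁻ {u = v} {w} {x} {xs} vw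
... | inj₁ (x≡u , v-later) | inj₁ (_ , w-later) = before-∷⁺ {xs = xs} (inj₁ (x≡u , w-later))
... | inj₁ (x≡u , v-later) | inj₂ vw-tail = before-∷⁺ {xs = xs} (inj₁ (x≡u , proj₂ (before⇒elem xs vw-tail)))
... | inj₂ uv-tail | inj₁ (refl , _) = ⊥-elim (<-irrefl refl (≤-trans (s≤s (elem⇒occurs xs (proj₂ (before⇒elem xs uv-tail))))
                                        (≤-trans (≤-reflexive (sym (occurrences-head xs))) at-most-once)))
... | inj₂ uv-tail | inj₂ vw-tail = before-∷⁺ {u = u} {w} {x} {xs} (inj₂ (before-transitive xs
        (≤-trans (m≤n+m (occurrences v xs) (indicator (x == v))) at-most-once) uv-tail vw-tail))

single-sequence-arc : ∀ {t} (q : List (Fin t)) {u v} → u ≢ v → arc (seqDigraph t (q ∷ [])) u v ≡ before u v q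
single-sequence-arc q {u} {v} u≢v =
  trans (cong (λ b → not b ∧ (before u v q ∨ false)) (dec-false (u F.≟ v) u≢v)) (∨-identityʳ (before u v q))

single-sequence-TT : ∀ {t} (q : List (Fin t)) → (∀ a → occurrences a q ≡ 1) →
  TransitiveTournament (seqDigraph t (q ∷ []))
single-sequence-TT {t} q once = tour , transitive
  where
  G = seqDigraph t (q ∷ [])
  as-arc : ∀ {u v} → u ≢ v → T (before u v q) → Arc G u v
  as-arc {u} {v} u≢v = subst T (sym (single-sequence-arc q u≢v))
  as-before : ∀ {u v} → Arc G u v → T (before u v q)
  as-before {u} {v} uv = subst T (single-sequence-arc q (arc⇒≢ {G} uv)) uv
  tour : IsTournament G
  tour u v u≢v with ordered q u≢v (once u) (once v)
  ... | inj₁ (uv , ¬vu) = inj₁ (as-arc u≢v uv , λ vu → ¬vu (as-before vu))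
  ... | inj₂ (vu , ¬uv) = inj₂ (as-arc (λ v≡u → u≢v (sym v≡u)) vu , λ uv → ¬uv (as-before uv))
  transitive : IsTransitive G
  transitive u v w uv vw u≢w = as-arc u≢w (before-transitive q (≤-reflexive (once v)) (as-before uv) (as-before vw))

-- (1) ⇒ (2): a member of S_{1,1} is given by at most one sequence in which every
-- type occurs exactly once.
InS⇒TT : ∀ {G} → InS 1 1 G → TransitiveTournament G
InS⇒TT (t , [] , _ , occurs , _ , G≅) =
  TT-transport G≅ ((λ u → ⊥-elim (absent u)) , (λ u → ⊥-elim (absent u)))
  where
  -- with no sequence there are no types, hence no vertices
  absent : Fin t → ⊥
  absent a = <-irrefl refl (occurs a)
InS⇒TT (t , q ∷ [] , _ , at-least , at-most , G≅) =
  TT-transport G≅ (single-sequence-TT q λ a →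
    trans (sym (occurrences-single a q)) (≤-antisym (at-most a) (at-least a)))
InS⇒TT (t , _ ∷ _ ∷ _ , s≤s () , _)

-- (2) ⇒ (1): list the vertices once each; by uniqueness of transitive
-- tournaments the resulting sequence digraph is G.
TT⇒InS : ∀ {G} → TransitiveTournament G → InS 1 1 G
TT⇒InS {G} isTT =
  size G , allFin (size G) ∷ [] , s≤s z≤n ,
  (λ a → ≤-reflexive (sym (once a))) , (λ a → ≤-reflexive (once a)) ,
  TT-unique isTT (single-sequence-TT (allFin (size G)) each-once) refl
  where
  each-once : ∀ a → occurrences a (allFin (size G)) ≡ 1
  each-once a = trans (sum-tabulate (λ x → indicator (x == a)) (λ i → i)) (count-single a)
  once : ∀ a → occ a (allFin (size G) ∷ []) ≡ 1
  once a = trans (occurrences-single a (allFin (size G))) (each-once a)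

via-TT : ∀ {G} {X : Set} → (TransitiveTournament G → X) → (X → TransitiveTournament G) → InS 1 1 G ⇔ X
via-TT forth back = mk⇔ (λ inS → forth (InS⇒TT inS)) (λ x → TT⇒InS (back x))

theorem4p16 : (G : Digraph) → 0 < size G →
    (InS 1 1 G ⇔ (IsTournament G × IsTransitive G)) ×
    (InS 1 1 G ⇔ (IsTournament G × IsAcyclic G)) ×
    (InS 1 1 G ⇔ (IsTournament G × Free G (C3 ∷ []))) ×
    (InS 1 1 G ⇔ (IsTournament G × ExactlyOneHamPath G)) ×
    (InS 1 1 G ⇔ (IsTournament G × OutdegreesAll G)) ×
    (InS 1 1 G ⇔ Free G (twoK1 ∷ biK2 ∷ C3 ∷ [])) ×
    (InS 1 1 G ⇔ ((G ≅ K1) ⊎ Σ ℕ (λ n → (2 ≤ n) × (G ≅ power (Pdir n) (n ∸ 1))))) ×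
    (InS 1 1 G ⇔ InGen OD G) ×
    (InS 1 1 G ⇔ InGen ID G)
theorem4p16 G nonempty =
  via-TT (λ isTT → isTT) (λ isTT → isTT) ,
  via-TT (λ isTT → proj₁ isTT , TT⇒acyclic {G} isTT)
         (λ (tour , acyclic) → tour , triangle-free⇒transitive {G} tour
            (λ u v w uv vw wu → acyclic (triangle⇒cycle {G} uv vw wu))) ,
  via-TT (λ isTT → proj₁ isTT , C3-free isTT ∷ [])
         (λ { (tour , no-C3 ∷ []) → no-C3⇒transitive tour no-C3 }) ,
  via-TT (λ isTT → proj₁ isTT , TT⇒unique-ham-path {G} isTT)
         (λ (tour , unique) → unique-ham-path⇒TT {G} nonempty tour unique) ,
  via-TT (λ isTT → proj₁ isTT , TT⇒outdegrees {G} isTT)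
         (λ (tour , distinct) → outdegrees⇒TT {G} tour distinct) ,
  via-TT (λ isTT → tournament⇒no-2K1 {G} (proj₁ isTT) ∷ tournament⇒no-biK2 {G} (proj₁ isTT) ∷ C3-free isTT ∷ [])
         (λ { (no-2K1 ∷ no-biK2 ∷ no-C3 ∷ []) →
            no-C3⇒transitive (no-2K1-biK2⇒tournament {G} no-2K1 no-biK2) no-C3 }) ,
  via-TT (TT⇒K1-or-power nonempty) K1-or-power⇒TT ,
  via-TT (TT⇒InGen (λ _ → refl) OD-TT nonempty) (InGen⇒TT OD-TT) ,
  via-TT (TT⇒InGen (λ _ → refl) ID-TT nonempty) (InGen⇒TT ID-TT)
  where
  C3-free : TransitiveTournament G → ¬ InducedSub C3 G
  C3-free isTT = triangle-free⇒C3-free {G} (TT⇒triangle-free {G} isTT)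
  no-C3⇒transitive : IsTournament G → ¬ InducedSub C3 G → TransitiveTournament G
  no-C3⇒transitive tour no-C3 =
    tour , triangle-free⇒transitive {G} tour (λ u v w uv vw wu → no-C3 (triangle⇒C3 {G} tour uv vw wu))
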